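{- Let $A$ be an improper Latin square of order $n$ whose improper cell is $(i_1,j)$, containing $a+b-s$ (so $A(i_1,j,a)=A(i_1,j,b)=1$ and $A(i_1,j,s)=-1$), and let $i_2\ne i_1$ be a row such that cell $(i_2,j)$ contains the symbol $s$ (i.e. $A(i_2,j,s)=1$). Then there is a sequence of at most $\frac{n-1}{2}$ $\pm1$-moves, each of which changes only cells in rows $i_1$ and $i_2$ and each of which produces an element of $S$, transforming $A$ into a proper Latin square.
   Context: Let $[n]=\{1,\dots,n\}$ index rows, columns and symbols. A proper or improper Latin square of order $n$ is a function $f:[n]^3\to\mathbb{Z}$ such that for every two fixed coordinates the sum over the third coordinate equals $1$, and either all values lie in $\{0,1\}$ (proper Latin square; equivalently an ordinary Latin square $L$ with $f(i,j,k)=1$ iff $L_{ij}=k$), or exactly one value equals $-1$ and all others lie in $\{0,1\}$ (improper Latin square). $S$ denotes the set of all proper and improper Latin squares of order $n$. If $f(i,j,s)=-1$, cell $(i,j)$ is the improper cell; it has exactly two symbols $a\ne b$ with value $1$, written $a+b-s$; every other cell contains exactly one symbol $x$ (value $1$), and we say the cell contains $x$. A $\pm1$-move replaces $f\in S$ by $f+\Delta$ with $\Delta=e_{(i,j,a)}+e_{(i,j',b)}+e_{(i',j,b)}+e_{(i',j',a)}-e_{(i,j,b)}-e_{(i,j',a)}-e_{(i',j,a)}-e_{(i',j',b)}$ for some $i\ne i'$, $j\ne j'$, $a\ne b$ ($e$ denotes indicator functions), provided $f+\Delta\in S$; it changes only cells $(i,j),(i,j'),(i',j),(i',j')$. -}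

module Defs where

open import Data.Nat using (ℕ; zero; suc)
open import Data.Fin using (Fin; _≟_)
import Data.Fin as F
open import Data.Integer using (ℤ; _+_; _-_; 0ℤ; 1ℤ; -1ℤ)
open import Data.Bool using (Bool; true; false; if_then_else_; _∧_)
open import Data.Product using (Σ; _×_; _,_; ∃)
open import Data.Sum using (_⊎_)
open import Relation.Nullary using (¬_)
open import Relation.Nullary.Decidable using (⌊_⌋)
open import Relation.Binary.PropositionalEquality using (_≡_; _≢_)

-- An integer-valued function on [n]^3 (rows, columns, symbols), indexed by Fin n.
Arr : ℕ → Set
Arr n = Fin n → Fin n → Fin n → ℤ

sumFin : (n : ℕ) → (Fin n → ℤ) → ℤ
sumFin zero    f = 0ℤ
sumFin (suc n) f = f F.zero + sumFin n (λ x → f (F.suc x))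

LineSums : {n : ℕ} → Arr n → Set
LineSums {n} f =
  (∀ j k → sumFin n (λ i → f i j k) ≡ 1ℤ) ×
  (∀ i k → sumFin n (λ j → f i j k) ≡ 1ℤ) ×
  (∀ i j → sumFin n (λ k → f i j k) ≡ 1ℤ)

ZeroOne : ℤ → Set
ZeroOne z = z ≡ 0ℤ ⊎ z ≡ 1ℤ

AllZeroOne : {n : ℕ} → Arr n → Set
AllZeroOne f = ∀ i j k → ZeroOne (f i j k)

OneMinusOne : {n : ℕ} → Arr n → Set
OneMinusOne {n} f =
  Σ (Fin n) λ i₀ → Σ (Fin n) λ j₀ → Σ (Fin n) λ k₀ →
    (f i₀ j₀ k₀ ≡ -1ℤ) ×
    (∀ i j k → ¬ (i ≡ i₀ × j ≡ j₀ × k ≡ k₀) → ZeroOne (f i j k))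

ProperLS : {n : ℕ} → Arr n → Set
ProperLS f = LineSums f × AllZeroOne f

ImproperLS : {n : ℕ} → Arr n → Set
ImproperLS f = LineSums f × OneMinusOne f

InS : {n : ℕ} → Arr n → Set
InS f = ProperLS f ⊎ ImproperLS f

e : {n : ℕ} → Fin n → Fin n → Fin n → Arr n
e x y z = λ i j k → if ⌊ i ≟ x ⌋ ∧ ⌊ j ≟ y ⌋ ∧ ⌊ k ≟ z ⌋ then 1ℤ else 0ℤ

Δ : {n : ℕ} → (i i' j j' a b : Fin n) → Arr n
Δ i i' j j' a b = λ x y z →
  e i j a x y z + e i j' b x y z + e i' j b x y z + e i' j' a x y z
  - e i j b x y z - e i j' a x y z - e i' j a x y z - e i' j' b x y z

MoveInRows : {n : ℕ} → Fin n → Fin n → Arr n → Arr n → Set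
MoveInRows {n} r₁ r₂ f g =
  Σ (Fin n) λ i → Σ (Fin n) λ i' → Σ (Fin n) λ j → Σ (Fin n) λ j' →
  Σ (Fin n) λ a → Σ (Fin n) λ b →
    (i ≢ i') × (j ≢ j') × (a ≢ b) ×
    (i ≡ r₁ ⊎ i ≡ r₂) × (i' ≡ r₁ ⊎ i' ≡ r₂) ×
    (∀ x y z → g x y z ≡ f x y z + Δ i i' j j' a b x y z) ×
    InS g

data Steps {A : Set} (R : A → A → Set) : ℕ → A → A → Set where
  done : ∀ {f} → Steps R 0 f f
  step : ∀ {k f g h} → R f g → Steps R k g h → Steps R (suc k) f h

module Submission where

open import Defs
open import Data.Nat using (ℕ; zero; suc; _≤_; _∸_)
import Data.Nat as ℕ
import Data.Nat.Properties as ℕₚ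
open import Data.Fin using (Fin; zero; suc; _≟_; splitAt; join; toℕ)
import Data.Fin.Properties as Fin
open import Data.Integer using (ℤ; +_; 0ℤ; 1ℤ; -1ℤ; _+_; _-_; _*_)
import Data.Integer.Properties as ℤ
open import Data.Integer.Tactic.RingSolver using (solve-∀)
open import Data.Bool using (Bool; true; false; if_then_else_; _∧_)
open import Data.Product using (Σ; _×_; _,_; ∃; proj₁; proj₂; map₁)
open import Data.Sum using (_⊎_; inj₁; inj₂; [_,_]′)
open import Function using (_∘_; id; Injective)
open import Relation.Nullary using (¬_; Dec; yes; no; contradiction)
open import Relation.Nullary.Decidable using (⌊_⌋)
open import Relation.Binary.PropositionalEquality
open ≡-Reasoning

-- Outside column j, rows i₁ and i₂ contain every symbol once each, except that a and b are missing from
-- row i₁ and s occurs twice in row i₁ and not in row i₂. Stepping from a column c to the column of row i₁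
-- that holds the symbol w of (i₂, c) therefore gives two walks, one from each column holding s in row i₁,
-- which stop when w is a or b; they visit distinct columns other than j, so the shorter has length k with
-- 2k ≤ n − 1. Along it, the ±1-move on rows i₁, i₂, columns j, c and symbols u, w (where the improper cell
-- is a + b − u) makes the improper cell a + b − w, and the square becomes proper once w ∈ {a, b}.

private variable
  n : ℕ

𝟙 : Bool → ℤ
𝟙 p = if p then 1ℤ else 0ℤ

δ : Fin n → Fin n → ℤ
δ x p = 𝟙 ⌊ x ≟ p ⌋

δ-refl : (x : Fin n) → δ x x ≡ 1ℤ
δ-refl x with x ≟ x
... | yes _ = refl
... | no x≢x = contradiction refl x≢x

δ-≢ : {x p : Fin n} → x ≢ p → δ x p ≡ 0ℤ
δ-≢ {x = x} {p} x≢p with x ≟ p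
... | yes x≡p = contradiction x≡p x≢p
... | no _ = refl

δ≡1⇒≡ : {x p : Fin n} → δ x p ≡ 1ℤ → x ≡ p
δ≡1⇒≡ {x = x} {p} eq with x ≟ p
... | yes x≡p = x≡p
δ≡1⇒≡ () | no _

δ-suc : (x p : Fin n) → δ (suc x) (suc p) ≡ δ x p
δ-suc x p = by-cases (x ≟ p)
  where
  by-cases : Dec (x ≡ p) → δ (suc x) (suc p) ≡ δ x p
  by-cases (yes refl) = trans (δ-refl (suc x)) (sym (δ-refl x))
  by-cases (no x≢p)   = trans (δ-≢ (x≢p ∘ Fin.suc-injective)) (sym (δ-≢ x≢p))

≡+suc⇒≢0 : ∀ {v m} → v ≡ + suc m → v ≢ 0ℤ
≡+suc⇒≢0 refl ()

ZeroOneValued : (Fin n → ℤ) → Set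
ZeroOneValued g = ∀ z → ZeroOne (g z)

not-ZeroOne-−1 : ∀ {v} → v ≡ -1ℤ → ¬ ZeroOne v
not-ZeroOne-−1 refl (inj₁ ())
not-ZeroOne-−1 refl (inj₂ ())

ZeroOne-δ : (x p : Fin n) → ZeroOne (δ x p)
ZeroOne-δ x p with x ≟ p
... | yes _ = inj₂ refl
... | no _ = inj₁ refl

sumFin-cong : ∀ n {f g : Fin n → ℤ} → (∀ x → f x ≡ g x) → sumFin n f ≡ sumFin n g
sumFin-cong zero    eq = refl
sumFin-cong (suc n) eq = cong₂ _+_ (eq zero) (sumFin-cong n (eq ∘ suc))

sumFin-+ : ∀ n (f g : Fin n → ℤ) → sumFin n (λ x → f x + g x) ≡ sumFin n f + sumFin n g
sumFin-+ zero    f g = refl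
sumFin-+ (suc n) f g =
  trans (cong (_+_ (f zero + g zero)) (sumFin-+ n (f ∘ suc) (g ∘ suc)))
        (interchange (f zero) (g zero) (sumFin n (f ∘ suc)) (sumFin n (g ∘ suc)))
  where
  interchange : ∀ a b c d → a + b + (c + d) ≡ a + c + (b + d)
  interchange = solve-∀

sumFin-minus : ∀ n (f g : Fin n → ℤ) → sumFin n (λ x → f x - g x) ≡ sumFin n f - sumFin n g
sumFin-minus zero    f g = refl
sumFin-minus (suc n) f g =
  trans (cong (_+_ (f zero - g zero)) (sumFin-minus n (f ∘ suc) (g ∘ suc)))
        (interchange (f zero) (g zero) (sumFin n (f ∘ suc)) (sumFin n (g ∘ suc)))
  where
  interchange : ∀ a b c d → a - b + (c - d) ≡ a + c - (b + d)
  interchange = solve-∀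

sumFin-*ˡ : ∀ n k (f : Fin n → ℤ) → sumFin n (λ x → k * f x) ≡ k * sumFin n f
sumFin-*ˡ zero    k f = sym (ℤ.*-zeroʳ k)
sumFin-*ˡ (suc n) k f =
  trans (cong (_+_ (k * f zero)) (sumFin-*ˡ n k (f ∘ suc))) (sym (ℤ.*-distribˡ-+ k _ _))

sumFin-*ʳ : ∀ n k (f : Fin n → ℤ) → sumFin n (λ x → f x * k) ≡ sumFin n f * k
sumFin-*ʳ n k f =
  trans (sumFin-cong n (λ x → ℤ.*-comm (f x) k)) (trans (sumFin-*ˡ n k f) (ℤ.*-comm k _))

sumFin-δ : ∀ n (p : Fin n) → sumFin n (λ x → δ x p) ≡ 1ℤ
sumFin-δ (suc n) zero    = cong (_+_ 1ℤ) (sumFin-0 n)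
  where
  sumFin-0 : ∀ n → sumFin n (λ _ → 0ℤ) ≡ 0ℤ
  sumFin-0 zero    = refl
  sumFin-0 (suc n) = trans (ℤ.+-identityˡ _) (sumFin-0 n)
sumFin-δ (suc n) (suc p) =
  trans (ℤ.+-identityˡ _) (trans (sumFin-cong n (λ x → δ-suc x p)) (sumFin-δ n p))

sumFin-δ-δ : ∀ n (p q : Fin n) → sumFin n (λ x → δ x p - δ x q) ≡ 0ℤ
sumFin-δ-δ n p q =
  trans (sumFin-minus n (λ x → δ x p) (λ x → δ x q)) (cong₂ _-_ (sumFin-δ n p) (sumFin-δ n q))

sumFin-suc-0 : ∀ {n} (g : Fin (suc n) → ℤ) → g zero ≡ 0ℤ → sumFin (suc n) g ≡ sumFin n (g ∘ suc)
sumFin-suc-0 {n} g g0≡0 = trans (cong (_+ sumFin n (g ∘ suc)) g0≡0) (ℤ.+-identityˡ _)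

ZeroOne-sum-ℕ : ∀ n {g : Fin n → ℤ} → ZeroOneValued g → ∃ λ m → sumFin n g ≡ + m
ZeroOne-sum-ℕ zero    zo = 0 , refl
ZeroOne-sum-ℕ (suc n) {g} zo with ZeroOne-sum-ℕ n (zo ∘ suc) | zo zero
... | m , rest≡m | inj₁ g0≡0 = m , trans (sumFin-suc-0 g g0≡0) rest≡m
... | m , rest≡m | inj₂ g0≡1 = suc m , cong₂ _+_ g0≡1 rest≡m

ZeroOne-sum≡0 : ∀ n {g : Fin n → ℤ} → ZeroOneValued g → sumFin n g ≡ 0ℤ → ∀ z → g z ≡ 0ℤ
ZeroOne-sum≡0 (suc n) {g} zo sum≡0 z with zo zero | ZeroOne-sum-ℕ n (zo ∘ suc)
... | inj₂ g0≡1 | m , rest≡m = contradiction (trans (sym (cong₂ _+_ g0≡1 rest≡m)) sum≡0) λ ()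
... | inj₁ g0≡0 | _ with z
...   | zero  = g0≡0
...   | suc z = ZeroOne-sum≡0 n (zo ∘ suc) (trans (sym (sumFin-suc-0 g g0≡0)) sum≡0) z

ZeroOne-sum≢0 : ∀ n {g : Fin n → ℤ} → ZeroOneValued g → sumFin n g ≢ 0ℤ → ∃ λ z → g z ≡ 1ℤ
ZeroOne-sum≢0 zero    zo sum≢0 = contradiction refl sum≢0
ZeroOne-sum≢0 (suc n) {g} zo sum≢0 with zo zero
... | inj₂ g0≡1 = zero , g0≡1
... | inj₁ g0≡0 with ZeroOne-sum≢0 n (zo ∘ suc) (sum≢0 ∘ trans (sumFin-suc-0 g g0≡0))
...   | z , gz≡1 = suc z , gz≡1

ZeroOne-minus-δ : {g : Fin n → ℤ} → ZeroOneValued g → ∀ {k} → g k ≡ 1ℤ → ∀ z → ZeroOne (g z - δ z k)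
ZeroOne-minus-δ {g = g} zo {k} gk≡1 z with z ≟ k
... | yes refl = inj₁ (cong (_- 1ℤ) gk≡1)
... | no _ = subst ZeroOne (sym (ℤ.+-identityʳ (g z))) (zo z)

sumFin-minus-δ : ∀ n (g : Fin n → ℤ) k → sumFin n (λ z → g z - δ z k) ≡ sumFin n g - 1ℤ
sumFin-minus-δ n g k = trans (sumFin-minus n g (λ z → δ z k)) (cong (_-_ (sumFin n g)) (sumFin-δ n k))

ZeroOne-sum≡1 : ∀ n {g : Fin n → ℤ} → ZeroOneValued g → sumFin n g ≡ 1ℤ →
                ∃ λ k → ∀ z → g z ≡ δ z k
ZeroOne-sum≡1 n {g} zo sum≡1 = k , λ z → ℤ.i-j≡0⇒i≡j (g z) (δ z k) (rest≡0 z)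
  where
  found : ∃ λ k → g k ≡ 1ℤ
  found = ZeroOne-sum≢0 n zo (≡+suc⇒≢0 sum≡1)
  k = proj₁ found
  rest≡0 : ∀ z → g z - δ z k ≡ 0ℤ
  rest≡0 = ZeroOne-sum≡0 n (ZeroOne-minus-δ zo (proj₂ found))
             (trans (sumFin-minus-δ n g k) (cong (_- 1ℤ) sum≡1))

ZeroOne-sum≡2 : ∀ n {g : Fin n → ℤ} → ZeroOneValued g → sumFin n g ≡ + 2 →
                ∀ {k} → g k ≡ 1ℤ → ∃ λ k' → k' ≢ k × ∀ z → g z ≡ δ z k + δ z k'
ZeroOne-sum≡2 n {g} zo sum≡2 {k} gk≡1 =
  k' , k'≢k , λ z → trans (split (g z) (δ z k)) (cong (_+_ (δ z k)) (rest≡δ z))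
  where
  indicator : ∃ λ k' → ∀ z → g z - δ z k ≡ δ z k'
  indicator = ZeroOne-sum≡1 n (ZeroOne-minus-δ zo gk≡1)
                (trans (sumFin-minus-δ n g k) (cong (_- 1ℤ) sum≡2))
  k' = proj₁ indicator
  rest≡δ = proj₂ indicator
  k'≢k : k' ≢ k
  k'≢k k'≡k = contradiction (trans (sym (cong₂ _-_ gk≡1 (δ-refl k))) gk-1≡1) λ ()
    where
    gk-1≡1 : g k - δ k k ≡ 1ℤ
    gk-1≡1 = trans (rest≡δ k) (trans (cong (δ k) k'≡k) (δ-refl k))
  split : ∀ a b → a ≡ b + (a - b)
  split = solve-∀

ZeroOne-sum≡1-unique : ∀ n {g : Fin n → ℤ} → ZeroOneValued g → sumFin n g ≡ 1ℤ →
                       ∀ {x y} → g x ≡ 1ℤ → g y ≡ 1ℤ → x ≡ y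
ZeroOne-sum≡1-unique n zo sum≡1 {x} {y} gx≡1 gy≡1 with ZeroOne-sum≡1 n zo sum≡1
... | k , g≗δk = trans (δ≡1⇒≡ (trans (sym (g≗δk x)) gx≡1))
                       (sym (δ≡1⇒≡ (trans (sym (g≗δk y)) gy≡1)))

ZeroOne-lift-−1 : ∀ n {g : Fin n → ℤ} {p} → (∀ z → z ≢ p → ZeroOne (g z)) → g p ≡ -1ℤ →
                  sumFin n g ≡ 1ℤ →
                  ZeroOneValued (λ z → g z + δ z p) × sumFin n (λ z → g z + δ z p) ≡ + 2
ZeroOne-lift-−1 n {g} {p} zo gp≡-1 sum≡1 =
  zo' , trans (sumFin-+ n g (λ z → δ z p)) (cong₂ _+_ sum≡1 (sumFin-δ n p))
  where
  zo' : ZeroOneValued (λ z → g z + δ z p)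
  zo' z with z ≟ p
  ... | yes refl = inj₁ (cong (_+ 1ℤ) gp≡-1)
  ... | no z≢p = subst ZeroOne (sym (ℤ.+-identityʳ (g z))) (zo z z≢p)

OneMinusOne-unique : {C : Arr n} → OneMinusOne C → ∀ {x y z} → C x y z ≡ -1ℤ →
                     ∀ x' y' z' → ¬ (x' ≡ x × y' ≡ y × z' ≡ z) → ZeroOne (C x' y' z')
OneMinusOne-unique (x₀ , y₀ , z₀ , _ , zo) {x} {y} {z} C≡-1 with x ≟ x₀ | y ≟ y₀ | z ≟ z₀
... | yes refl | yes refl | yes refl = zo
... | no x≢x₀  | _        | _        = contradiction (zo x y z (x≢x₀ ∘ proj₁)) (not-ZeroOne-−1 C≡-1)
... | yes _    | no y≢y₀  | _        = contradiction (zo x y z (y≢y₀ ∘ proj₁ ∘ proj₂)) (not-ZeroOne-−1 C≡-1)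
... | yes _    | yes _    | no z≢z₀  = contradiction (zo x y z (z≢z₀ ∘ proj₂ ∘ proj₂)) (not-ZeroOne-−1 C≡-1)

𝟙-∧ : ∀ p q → 𝟙 (p ∧ q) ≡ 𝟙 p * 𝟙 q
𝟙-∧ true  q = sym (ℤ.*-identityˡ (𝟙 q))
𝟙-∧ false q = sym (ℤ.*-zeroˡ (𝟙 q))

𝟙-∧³ : ∀ p q r → 𝟙 (p ∧ q ∧ r) ≡ 𝟙 p * 𝟙 q * 𝟙 r
𝟙-∧³ p q r =
  trans (𝟙-∧ p (q ∧ r)) (trans (cong (𝟙 p *_) (𝟙-∧ q r)) (sym (ℤ.*-assoc (𝟙 p) (𝟙 q) (𝟙 r))))

Δ-𝟙 : ∀ p p' q q' r r' →
  𝟙 (p ∧ q ∧ r) + 𝟙 (p ∧ q' ∧ r') + 𝟙 (p' ∧ q ∧ r') + 𝟙 (p' ∧ q' ∧ r)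
  - 𝟙 (p ∧ q ∧ r') - 𝟙 (p ∧ q' ∧ r) - 𝟙 (p' ∧ q ∧ r) - 𝟙 (p' ∧ q' ∧ r')
  ≡ (𝟙 p - 𝟙 p') * (𝟙 q - 𝟙 q') * (𝟙 r - 𝟙 r')
Δ-𝟙 p p' q q' r r'
  rewrite 𝟙-∧³ p q r | 𝟙-∧³ p q' r' | 𝟙-∧³ p' q r' | 𝟙-∧³ p' q' r
        | 𝟙-∧³ p q r' | 𝟙-∧³ p q' r | 𝟙-∧³ p' q r | 𝟙-∧³ p' q' r'
  = expand (𝟙 p) (𝟙 p') (𝟙 q) (𝟙 q') (𝟙 r) (𝟙 r')
  where
  expand : ∀ P P' Q Q' R R' →
    P * Q * R + P * Q' * R' + P' * Q * R' + P' * Q' * R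
    - P * Q * R' - P * Q' * R - P' * Q * R - P' * Q' * R'
    ≡ (P - P') * (Q - Q') * (R - R')
  expand = solve-∀

Δ-factor : ∀ (i i' j j' a b x y z : Fin n) →
  Δ i i' j j' a b x y z ≡ (δ x i - δ x i') * (δ y j - δ y j') * (δ z a - δ z b)
Δ-factor i i' j j' a b x y z =
  Δ-𝟙 ⌊ x ≟ i ⌋ ⌊ x ≟ i' ⌋ ⌊ y ≟ j ⌋ ⌊ y ≟ j' ⌋ ⌊ z ≟ a ⌋ ⌊ z ≟ b ⌋

module _ {n} (i i' j j' a b : Fin n) where
  private
    σ τ ρ : Fin n → ℤ
    σ x = δ x i - δ x i'
    τ y = δ y j - δ y j'
    ρ z = δ z a - δ z b

  sumFin-Δ-rows : ∀ y z → sumFin n (λ x → Δ i i' j j' a b x y z) ≡ 0ℤ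
  sumFin-Δ-rows y z = begin
    sumFin n (λ x → Δ i i' j j' a b x y z)   ≡⟨ sumFin-cong n (λ x → Δ-factor i i' j j' a b x y z) ⟩
    sumFin n (λ x → σ x * τ y * ρ z)         ≡⟨ sumFin-*ʳ n (ρ z) (λ x → σ x * τ y) ⟩
    sumFin n (λ x → σ x * τ y) * ρ z         ≡⟨ cong (_* ρ z) (sumFin-*ʳ n (τ y) σ) ⟩
    sumFin n σ * τ y * ρ z                   ≡⟨ cong (λ t → t * τ y * ρ z) (sumFin-δ-δ n i i') ⟩
    0ℤ * τ y * ρ z                           ≡⟨ ℤ.*-zeroˡ (τ y * ρ z) ⟩
    0ℤ                                       ∎

  sumFin-Δ-columns : ∀ x z → sumFin n (λ y → Δ i i' j j' a b x y z) ≡ 0ℤ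
  sumFin-Δ-columns x z = begin
    sumFin n (λ y → Δ i i' j j' a b x y z)   ≡⟨ sumFin-cong n (λ y → Δ-factor i i' j j' a b x y z) ⟩
    sumFin n (λ y → σ x * τ y * ρ z)         ≡⟨ sumFin-*ʳ n (ρ z) (λ y → σ x * τ y) ⟩
    sumFin n (λ y → σ x * τ y) * ρ z         ≡⟨ cong (_* ρ z) (sumFin-*ˡ n (σ x) τ) ⟩
    σ x * sumFin n τ * ρ z                   ≡⟨ cong (λ t → σ x * t * ρ z) (sumFin-δ-δ n j j') ⟩
    σ x * 0ℤ * ρ z                           ≡⟨ cong (_* ρ z) (ℤ.*-zeroʳ (σ x)) ⟩
    0ℤ * ρ z                                 ≡⟨ ℤ.*-zeroˡ (ρ z) ⟩
    0ℤ                                       ∎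

  sumFin-Δ-symbols : ∀ x y → sumFin n (λ z → Δ i i' j j' a b x y z) ≡ 0ℤ
  sumFin-Δ-symbols x y = begin
    sumFin n (λ z → Δ i i' j j' a b x y z)   ≡⟨ sumFin-cong n (λ z → Δ-factor i i' j j' a b x y z) ⟩
    sumFin n (λ z → σ x * τ y * ρ z)         ≡⟨ sumFin-*ˡ n (σ x * τ y) ρ ⟩
    σ x * τ y * sumFin n ρ                   ≡⟨ cong (σ x * τ y *_) (sumFin-δ-δ n a b) ⟩
    σ x * τ y * 0ℤ                           ≡⟨ ℤ.*-zeroʳ (σ x * τ y) ⟩
    0ℤ                                       ∎

  LineSums-+Δ : {C : Arr n} → LineSums C → LineSums (λ x y z → C x y z + Δ i i' j j' a b x y z)
  LineSums-+Δ {C} (rows , columns , symbols) =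
    (λ y z → add (λ x → C x y z) (λ x → Δ i i' j j' a b x y z) (rows y z) (sumFin-Δ-rows y z)) ,
    (λ x z → add (λ y → C x y z) (λ y → Δ i i' j j' a b x y z) (columns x z) (sumFin-Δ-columns x z)) ,
    (λ x y → add (λ z → C x y z) (λ z → Δ i i' j j' a b x y z) (symbols x y) (sumFin-Δ-symbols x y))
    where
    add : ∀ f g → sumFin n f ≡ 1ℤ → sumFin n g ≡ 0ℤ → sumFin n (λ x → f x + g x) ≡ 1ℤ
    add f g f≡1 g≡0 = trans (sumFin-+ n f g) (cong₂ _+_ f≡1 g≡0)

avoiding-injection-≤ : ∀ {k n} (p : Fin n) {h : Fin k → Fin n} →
                       Injective _≡_ _≡_ h → (∀ i → h i ≢ p) → k ≤ n ∸ 1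
avoiding-injection-≤ {n = suc _} p h-inj h≢p =
  Fin.injective⇒≤ (h-inj ∘ Fin.punchOut-injective (h≢p _ ∘ sym) (h≢p _ ∘ sym))

disjoint-injections-≤ : ∀ {k m n} (p : Fin n) {f : Fin k → Fin n} {g : Fin m → Fin n} →
                        Injective _≡_ _≡_ f → Injective _≡_ _≡_ g → (∀ i i' → f i ≢ g i') →
                        (∀ i → f i ≢ p) → (∀ i → g i ≢ p) → k ℕ.+ m ≤ n ∸ 1
disjoint-injections-≤ {k} {m} p {f} {g} f-inj g-inj f≢g f≢p g≢p =
  avoiding-injection-≤ p {h = [ f , g ]′ ∘ splitAt k} h-inj (≢p ∘ splitAt k)
  where
  [f,g]-inj : Injective _≡_ _≡_ [ f , g ]′
  [f,g]-inj {inj₁ i} {inj₁ i'} eq = cong inj₁ (f-inj eq)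
  [f,g]-inj {inj₁ i} {inj₂ i'} eq = contradiction eq (f≢g i i')
  [f,g]-inj {inj₂ i} {inj₁ i'} eq = contradiction (sym eq) (f≢g i' i)
  [f,g]-inj {inj₂ i} {inj₂ i'} eq = cong inj₂ (g-inj eq)
  h-inj : Injective _≡_ _≡_ ([ f , g ]′ ∘ splitAt k)
  h-inj {i} {i'} eq = begin
    i                        ≡⟨ Fin.join-splitAt k m i ⟨
    join k m (splitAt k i)   ≡⟨ cong (join k m) ([f,g]-inj {splitAt k i} {splitAt k i'} eq) ⟩
    join k m (splitAt k i')  ≡⟨ Fin.join-splitAt k m i' ⟩
    i'                       ∎
  ≢p : ∀ v → [ f , g ]′ v ≢ p
  ≢p (inj₁ i) = f≢p i
  ≢p (inj₂ i) = g≢p i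

Contains : Arr n → Fin n → Fin n → Fin n → Set
Contains C x y k = ∀ z → C x y z ≡ δ z k

module TwoRows {n} (i₁ i₂ j a b : Fin n) (i₂≢i₁ : i₂ ≢ i₁) (a≢b : a ≢ b) where

  record Improper (C : Arr n) (u : Fin n) : Set where
    field
      lineSums     : LineSums C
      improperCell : ∀ z → C i₁ j z ≡ δ z a + δ z b - δ z u
      u≢a          : u ≢ a
      u≢b          : u ≢ b
      i₂j∋u        : C i₂ j u ≡ 1ℤ
      zeroOne      : ∀ x y z → ¬ (x ≡ i₁ × y ≡ j) → ZeroOne (C x y z)

    rowSums : ∀ x z → sumFin n (λ y → C x y z) ≡ 1ℤ
    rowSums = proj₁ (proj₂ lineSums)

    cellSums : ∀ x y → sumFin n (λ z → C x y z) ≡ 1ℤ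
    cellSums = proj₂ (proj₂ lineSums)

  ZeroOne-a+b-u : ∀ {u z} → z ≢ u → ZeroOne (δ z a + δ z b - δ z u)
  ZeroOne-a+b-u {u} {z} z≢u with z ≟ a
  ... | yes refl = inj₂ (cong₂ (λ p q → 1ℤ + p - q) (δ-≢ a≢b) (δ-≢ z≢u))
  ... | no z≢a   = subst ZeroOne (sym (trans (cong (λ q → 0ℤ + δ z b - q) (δ-≢ z≢u)) (drop (δ z b))))
                                 (ZeroOne-δ z b)
    where
    drop : ∀ d → 0ℤ + d - 0ℤ ≡ d
    drop = solve-∀

  module ImproperProperties {C : Arr n} {u : Fin n} (I : Improper C u) where
    open Improper I

    private
      notImproper₂ : ∀ {y} → ¬ (i₂ ≡ i₁ × y ≡ j)
      notImproper₂ = i₂≢i₁ ∘ proj₁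

    cellContents : ∀ {x y} → ¬ (x ≡ i₁ × y ≡ j) → ∃ (Contains C x y)
    cellContents {x} {y} proper = ZeroOne-sum≡1 n (λ z → zeroOne x y z proper) (cellSums x y)

    contains : ∀ {x y k} → ¬ (x ≡ i₁ × y ≡ j) → C x y k ≡ 1ℤ → Contains C x y k
    contains {x} {y} {k} proper Cxyk≡1 z =
      trans (∋k' z) (cong (δ z) (sym (δ≡1⇒≡ (trans (sym (∋k' k)) Cxyk≡1))))
      where
      ∋k' = proj₂ (cellContents proper)

    cell-unique : ∀ {x y k k'} → ¬ (x ≡ i₁ × y ≡ j) →
                  C x y k ≡ 1ℤ → C x y k' ≡ 1ℤ → k' ≡ k
    cell-unique proper Cxyk≡1 Cxyk'≡1 = δ≡1⇒≡ (trans (sym (contains proper Cxyk≡1 _)) Cxyk'≡1)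

    row₂-unique : ∀ {y y' w} → C i₂ y w ≡ 1ℤ → C i₂ y' w ≡ 1ℤ → y ≡ y'
    row₂-unique {w = w} = ZeroOne-sum≡1-unique n (λ y → zeroOne i₂ y w notImproper₂) (rowSums i₂ w)

    row₂-symbol : ∀ y → ∃ λ w → C i₂ y w ≡ 1ℤ
    row₂-symbol y =
      let w , ∋w = cellContents notImproper₂ in w , trans (∋w w) (δ-refl w)

    ZeroOne-improperCell : ∀ {z} → z ≢ u → ZeroOne (C i₁ j z)
    ZeroOne-improperCell z≢u = subst ZeroOne (sym (improperCell _)) (ZeroOne-a+b-u z≢u)

    row₁-column : ∀ {z} → z ≢ u → ∃ λ y → C i₁ y z ≡ 1ℤ
    row₁-column {z} z≢u = ZeroOne-sum≢0 n zeroOne-row₁ (≡+suc⇒≢0 (rowSums i₁ z))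
      where
      zeroOne-row₁ : ZeroOneValued (λ y → C i₁ y z)
      zeroOne-row₁ y with y ≟ j
      ... | yes refl = ZeroOne-improperCell z≢u
      ... | no y≢j   = zeroOne i₁ y z (y≢j ∘ proj₂)

    Improper⇒ImproperLS : ImproperLS C
    Improper⇒ImproperLS = lineSums , i₁ , j , u , C-at-u , zeroOne-elsewhere
      where
      C-at-u : C i₁ j u ≡ -1ℤ
      C-at-u = trans (improperCell u) (cong₂ _-_ (cong₂ _+_ (δ-≢ u≢a) (δ-≢ u≢b)) (δ-refl u))
      zeroOne-elsewhere : ∀ x y z → ¬ (x ≡ i₁ × y ≡ j × z ≡ u) → ZeroOne (C x y z)
      zeroOne-elsewhere x y z not-u with x ≟ i₁ | y ≟ j
      ... | yes refl | yes refl = ZeroOne-improperCell (λ z≡u → not-u (refl , refl , z≡u))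
      ... | no x≢i₁  | _        = zeroOne x y z (x≢i₁ ∘ proj₁)
      ... | yes _    | no y≢j   = zeroOne x y z (y≢j ∘ proj₂)

  Improper-initial : ∀ {A : Arr n} {s} → ImproperLS A →
                     A i₁ j s ≡ -1ℤ → A i₁ j a ≡ 1ℤ → A i₁ j b ≡ 1ℤ → A i₂ j s ≡ 1ℤ → Improper A s
  Improper-initial {A} {s} (lineSums , oneMinusOne) i₁js≡-1 i₁ja≡1 i₁jb≡1 i₂js≡1 = record
    { lineSums     = lineSums
    ; improperCell = improperCell
    ; u≢a          = s≢ i₁ja≡1
    ; u≢b          = s≢ i₁jb≡1
    ; i₂j∋u        = i₂js≡1
    ; zeroOne      = λ x y z not-improper → zeroOne x y z (not-improper ∘ λ (x≡ , y≡ , _) → x≡ , y≡)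
    }
    where
    zeroOne : ∀ x y z → ¬ (x ≡ i₁ × y ≡ j × z ≡ s) → ZeroOne (A x y z)
    zeroOne = OneMinusOne-unique oneMinusOne i₁js≡-1

    s≢ : ∀ {k} → A i₁ j k ≡ 1ℤ → s ≢ k
    s≢ i₁jk≡1 refl = contradiction (trans (sym i₁js≡-1) i₁jk≡1) λ ()

    lifted : ZeroOneValued (λ z → A i₁ j z + δ z s) × sumFin n (λ z → A i₁ j z + δ z s) ≡ + 2
    lifted = ZeroOne-lift-−1 n (λ z z≢s → zeroOne i₁ j z (z≢s ∘ proj₂ ∘ proj₂)) i₁js≡-1
               (proj₂ (proj₂ lineSums) i₁ j)

    lifted∋ : ∀ {k} → A i₁ j k ≡ 1ℤ → A i₁ j k + δ k s ≡ 1ℤ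
    lifted∋ {k} i₁jk≡1 = cong₂ _+_ i₁jk≡1 (δ-≢ (s≢ i₁jk≡1 ∘ sym))

    improperCell : ∀ z → A i₁ j z ≡ δ z a + δ z b - δ z s
    improperCell z with ZeroOne-sum≡2 n (proj₁ lifted) (proj₂ lifted) (lifted∋ i₁ja≡1)
    ... | k , k≢a , lifted≗ = begin
      A i₁ j z                  ≡⟨ unlift (A i₁ j z) (δ z s) ⟩
      A i₁ j z + δ z s - δ z s  ≡⟨ cong (_- δ z s) (lifted≗ z) ⟩
      δ z a + δ z k - δ z s     ≡⟨ cong (λ v → δ z a + δ z v - δ z s) (sym b≡k) ⟩
      δ z a + δ z b - δ z s     ∎
      where
      unlift : ∀ V D → V ≡ V + D - D
      unlift = solve-∀
      δbk≡1 : δ b k ≡ 1ℤ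
      δbk≡1 = begin
        δ b k          ≡⟨ ℤ.+-identityˡ (δ b k) ⟨
        0ℤ + δ b k     ≡⟨ cong (_+ δ b k) (δ-≢ (a≢b ∘ sym)) ⟨
        δ b a + δ b k  ≡⟨ lifted≗ b ⟨
        A i₁ j b + δ b s ≡⟨ lifted∋ i₁jb≡1 ⟩
        1ℤ             ∎
      b≡k : b ≡ k
      b≡k = δ≡1⇒≡ δbk≡1

  module Move {C : Arr n} {u : Fin n} (I : Improper C u)
              {c : Fin n} (c≢j : c ≢ j) (i₁c∋u : C i₁ c u ≡ 1ℤ)
              {w : Fin n} (i₂c∋w : C i₂ c w ≡ 1ℤ) where
    open Improper I
    open ImproperProperties I

    C' : Arr n
    C' x y z = C x y z + Δ i₁ i₂ j c u w x y z

    private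
      i₁≢i₂ : i₁ ≢ i₂
      i₁≢i₂ = i₂≢i₁ ∘ sym

      j≢c : j ≢ c
      j≢c = c≢j ∘ sym

      D : Fin n → ℤ
      D z = δ z u - δ z w

    u≢w : u ≢ w
    u≢w refl = c≢j (sym (row₂-unique i₂j∋u i₂c∋w))

    C'-at : ∀ {x y σ τ} → δ x i₁ - δ x i₂ ≡ σ → δ y j - δ y c ≡ τ →
            ∀ z → C' x y z ≡ C x y z + σ * τ * D z
    C'-at {x} {y} σ-eq τ-eq z =
      cong (_+_ (C x y z))
           (trans (Δ-factor i₁ i₂ j c u w x y z) (cong₂ (λ σ τ → σ * τ * D z) σ-eq τ-eq))

    C'-outside-rows : ∀ {x} → x ≢ i₁ → x ≢ i₂ → ∀ y z → C' x y z ≡ C x y z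
    C'-outside-rows x≢i₁ x≢i₂ y z =
      trans (C'-at (cong₂ _-_ (δ-≢ x≢i₁) (δ-≢ x≢i₂)) refl z) (ℤ.+-identityʳ _)

    C'-outside-columns : ∀ {y} → y ≢ j → y ≢ c → ∀ x z → C' x y z ≡ C x y z
    C'-outside-columns {y} y≢j y≢c x z = begin
      C' x y z                ≡⟨ C'-at refl (cong₂ _-_ (δ-≢ y≢j) (δ-≢ y≢c)) z ⟩
      C x y z + σ * 0ℤ * D z  ≡⟨ cong (λ t → C x y z + t * D z) (ℤ.*-zeroʳ σ) ⟩
      C x y z + 0ℤ * D z      ≡⟨ cong (_+_ (C x y z)) (ℤ.*-zeroˡ (D z)) ⟩
      C x y z + 0ℤ            ≡⟨ ℤ.+-identityʳ _ ⟩
      C x y z                 ∎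
      where
      σ = δ x i₁ - δ x i₂

    private
      row-i₁ : δ i₁ i₁ - δ i₁ i₂ ≡ 1ℤ
      row-i₁ = cong₂ _-_ (δ-refl i₁) (δ-≢ i₁≢i₂)
      row-i₂ : δ i₂ i₁ - δ i₂ i₂ ≡ -1ℤ
      row-i₂ = cong₂ _-_ (δ-≢ i₂≢i₁) (δ-refl i₂)
      column-j : δ j j - δ j c ≡ 1ℤ
      column-j = cong₂ _-_ (δ-refl j) (δ-≢ j≢c)
      column-c : δ c j - δ c c ≡ -1ℤ
      column-c = cong₂ _-_ (δ-≢ c≢j) (δ-refl c)

      replace : ∀ {x y k σ τ} → δ x i₁ - δ x i₂ ≡ σ → δ y j - δ y c ≡ τ → ¬ (x ≡ i₁ × y ≡ j) →
                C x y k ≡ 1ℤ → ∀ z → C' x y z ≡ δ z k + σ * τ * D z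
      replace σ-eq τ-eq proper Cxyk≡1 z =
        trans (C'-at σ-eq τ-eq z) (cong (_+ _) (contains proper Cxyk≡1 z))

      u↦w : ∀ U W → U + -1ℤ * (U - W) ≡ W
      u↦w = solve-∀
      w↦u : ∀ U W → W + 1ℤ * (U - W) ≡ U
      w↦u = solve-∀

    C'-improperCell : ∀ z → C' i₁ j z ≡ δ z a + δ z b - δ z w
    C'-improperCell z = begin
      C' i₁ j z                                     ≡⟨ C'-at row-i₁ column-j z ⟩
      C i₁ j z + 1ℤ * D z                           ≡⟨ cong (_+ 1ℤ * D z) (improperCell z) ⟩
      δ z a + δ z b - δ z u + 1ℤ * (δ z u - δ z w)  ≡⟨ telescope (δ z a + δ z b) (δ z u) (δ z w) ⟩
      δ z a + δ z b - δ z w                         ∎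
      where
      telescope : ∀ V U W → V - U + 1ℤ * (U - W) ≡ V - W
      telescope = solve-∀

    i₁c∋w : Contains C' i₁ c w
    i₁c∋w z = trans (replace row-i₁ column-c (c≢j ∘ proj₂) i₁c∋u z) (u↦w (δ z u) (δ z w))

    i₂j∋w : Contains C' i₂ j w
    i₂j∋w z = trans (replace row-i₂ column-j (i₂≢i₁ ∘ proj₁) i₂j∋u z) (u↦w (δ z u) (δ z w))

    i₂c∋u : Contains C' i₂ c u
    i₂c∋u z = trans (replace row-i₂ column-c (i₂≢i₁ ∘ proj₁) i₂c∋w z) (w↦u (δ z u) (δ z w))

    C'-zeroOne : ∀ x y z → ¬ (x ≡ i₁ × y ≡ j) → ZeroOne (C' x y z)
    C'-zeroOne x y z = by-cases x y (x ≟ i₁) (x ≟ i₂) (y ≟ j) (y ≟ c)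
      where
      by-cases : ∀ x y → Dec (x ≡ i₁) → Dec (x ≡ i₂) → Dec (y ≡ j) → Dec (y ≡ c) →
                 ¬ (x ≡ i₁ × y ≡ j) → ZeroOne (C' x y z)
      by-cases _ _ (yes refl) _          (yes refl) _          not-improper =
        contradiction (refl , refl) not-improper
      by-cases _ _ (yes refl) _          (no _)     (yes refl) _ = subst ZeroOne (sym (i₁c∋w z)) (ZeroOne-δ z w)
      by-cases _ _ (no _)     (yes refl) (yes refl) _          _ = subst ZeroOne (sym (i₂j∋w z)) (ZeroOne-δ z w)
      by-cases _ _ (no _)     (yes refl) (no _)     (yes refl) _ = subst ZeroOne (sym (i₂c∋u z)) (ZeroOne-δ z u)
      by-cases x y (no x≢i₁)  (no x≢i₂)  _          _          not-improper =
        subst ZeroOne (sym (C'-outside-rows x≢i₁ x≢i₂ y z)) (zeroOne x y z not-improper)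
      by-cases x y _          _          (no y≢j)   (no y≢c)   not-improper =
        subst ZeroOne (sym (C'-outside-columns y≢j y≢c x z)) (zeroOne x y z not-improper)

    C'-improper : w ≢ a → w ≢ b → Improper C' w
    C'-improper w≢a w≢b = record
      { lineSums     = LineSums-+Δ i₁ i₂ j c u w lineSums
      ; improperCell = C'-improperCell
      ; u≢a          = w≢a
      ; u≢b          = w≢b
      ; i₂j∋u        = trans (i₂j∋w w) (δ-refl w)
      ; zeroOne      = C'-zeroOne
      }

    C'-proper : w ≡ a ⊎ w ≡ b → ProperLS C'
    C'-proper w∈ab = LineSums-+Δ i₁ i₂ j c u w lineSums , λ x y z → by-cases x y z (x ≟ i₁) (y ≟ j)
      where
      a+b-a : ∀ A B → A + B - A ≡ B
      a+b-a = solve-∀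
      a+b-b : ∀ A B → A + B - B ≡ A
      a+b-b = solve-∀
      resolved : w ≡ a ⊎ w ≡ b → ∀ z → ZeroOne (C' i₁ j z)
      resolved (inj₁ w≡a) z = subst ZeroOne (sym (trans (C'-improperCell z)
                                (trans (cong (λ v → δ z a + δ z b - δ z v) w≡a) (a+b-a (δ z a) (δ z b)))))
                                (ZeroOne-δ z b)
      resolved (inj₂ w≡b) z = subst ZeroOne (sym (trans (C'-improperCell z)
                                (trans (cong (λ v → δ z a + δ z b - δ z v) w≡b) (a+b-b (δ z a) (δ z b)))))
                                (ZeroOne-δ z a)
      by-cases : ∀ x y z → Dec (x ≡ i₁) → Dec (y ≡ j) → ZeroOne (C' x y z)
      by-cases _ _ z (yes refl) (yes refl) = resolved w∈ab z
      by-cases x y z (no x≢i₁)  _          = C'-zeroOne x y z (x≢i₁ ∘ proj₁)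
      by-cases x y z (yes _)    (no y≢j)   = C'-zeroOne x y z (y≢j ∘ proj₂)

    move : MoveInRows i₁ i₂ C C'
    move = i₁ , i₂ , j , c , u , w , i₁≢i₂ , j≢c , u≢w , inj₁ refl , inj₂ refl , (λ _ _ _ → refl) , C'∈S
      where
      C'∈S : InS C'
      C'∈S with w ≟ a | w ≟ b
      ... | yes w≡a | _       = inj₁ (C'-proper (inj₁ w≡a))
      ... | no _    | yes w≡b = inj₁ (C'-proper (inj₂ w≡b))
      ... | no w≢a  | no w≢b  = inj₂ (ImproperProperties.Improper⇒ImproperLS (C'-improper w≢a w≢b))

  module Walks {A : Arr n} {s : Fin n} (I : Improper A s) where
    open Improper I
    open ImproperProperties I

    symbol₂ : Fin n → Fin n
    symbol₂ y = proj₁ (row₂-symbol y)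

    symbol₂∋ : ∀ y → A i₂ y (symbol₂ y) ≡ 1ℤ
    symbol₂∋ y = proj₂ (row₂-symbol y)

    symbol₂≢s : ∀ {y} → y ≢ j → symbol₂ y ≢ s
    symbol₂≢s y≢j symbol≡s = y≢j (row₂-unique (subst (λ z → A i₂ _ z ≡ 1ℤ) symbol≡s (symbol₂∋ _)) i₂j∋u)

    -- j is a junk value: along a walk the symbol of (i₂, y) is never s, by symbol₂≢s.
    next : Fin n → Fin n
    next y with symbol₂ y ≟ s
    ... | yes _   = j
    ... | no z≢s  = proj₁ (row₁-column z≢s)

    next∋ : ∀ {y} → y ≢ j → A i₁ (next y) (symbol₂ y) ≡ 1ℤ
    next∋ {y} y≢j with symbol₂ y ≟ s
    ... | yes z≡s = contradiction z≡s (symbol₂≢s y≢j)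
    ... | no z≢s  = proj₂ (row₁-column z≢s)

    walk : Fin n → ℕ → Fin n
    walk c zero    = c
    walk c (suc t) = next (walk c t)

    -- In A, the column walk c t holds entrySymbol c t in row i₁ and exitSymbol c t in row i₂.
    exitSymbol : Fin n → ℕ → Fin n
    exitSymbol c t = symbol₂ (walk c t)

    entrySymbol : Fin n → ℕ → Fin n
    entrySymbol c zero    = s
    entrySymbol c (suc t) = exitSymbol c t

    Stops Continues : Fin n → ℕ → Set
    Stops     c t = exitSymbol c t ≡ a ⊎ exitSymbol c t ≡ b
    Continues c t = exitSymbol c t ≢ a × exitSymbol c t ≢ b

    stops? : ∀ c t → Stops c t ⊎ Continues c t
    stops? c t with exitSymbol c t ≟ a | exitSymbol c t ≟ b
    ... | yes z≡a | _       = inj₁ (inj₁ z≡a)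
    ... | no _    | yes z≡b = inj₁ (inj₂ z≡b)
    ... | no z≢a  | no z≢b  = inj₂ (z≢a , z≢b)

    Alive : Fin n → ℕ → Set
    Alive c t = ∀ t' → t' ℕ.< t → Continues c t'

    Alive-≤ : ∀ {c t t'} → t' ≤ t → Alive c t → Alive c t'
    Alive-≤ t'≤t alive t'' t''<t' = alive t'' (ℕₚ.<-≤-trans t''<t' t'≤t)

    Alive-pred : ∀ {c t} → Alive c (suc t) → Alive c t
    Alive-pred {t = t} = Alive-≤ (ℕₚ.n≤1+n t)

    Alive-suc : ∀ {c t} → Alive c t → Continues c t → Alive c (suc t)
    Alive-suc alive continues t' t'<1+t with ℕₚ.m<1+n⇒m<n∨m≡n t'<1+t
    ... | inj₁ t'<t = alive t' t'<t
    ... | inj₂ refl = continues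

    Start : Fin n → Set
    Start c = c ≢ j × A i₁ c s ≡ 1ℤ

    walk-valid : ∀ {c} → Start c → ∀ t → Alive c t →
                 walk c t ≢ j × A i₁ (walk c t) (entrySymbol c t) ≡ 1ℤ
    walk-valid start zero    _     = start
    walk-valid {c} start (suc t) alive = next≢j , next∋ y≢j
      where
      y≢j = proj₁ (walk-valid start t (Alive-pred alive))
      z   = exitSymbol c t
      z≢a×z≢b = alive t (ℕₚ.n<1+n t)
      i₁jz≡0 : A i₁ j z ≡ 0ℤ
      i₁jz≡0 = trans (improperCell z)
                 (cong₂ _-_ (cong₂ _+_ (δ-≢ (proj₁ z≢a×z≢b)) (δ-≢ (proj₂ z≢a×z≢b))) (δ-≢ (symbol₂≢s y≢j)))
      next≢j : next (walk c t) ≢ j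
      next≢j next≡j =
        contradiction (trans (sym (subst (λ y → A i₁ y z ≡ 1ℤ) next≡j (next∋ y≢j))) i₁jz≡0) λ ()

    walk-suc≢start : ∀ {c c'} → Start c → Start c' → ∀ t → Alive c (suc t) → walk c (suc t) ≢ c'
    walk-suc≢start {c} start (c'≢j , i₁c'∋s) t alive walk≡c' =
      symbol₂≢s (proj₁ (walk-valid start t (Alive-pred alive)))
        (cell-unique (c'≢j ∘ proj₂) i₁c'∋s
          (subst (λ y → A i₁ y (exitSymbol c t) ≡ 1ℤ) walk≡c' (proj₂ (walk-valid start (suc t) alive))))

    walk-suc-injective : ∀ {c c'} → Start c → Start c' → ∀ t t' → Alive c (suc t) → Alive c' (suc t') →
                         walk c (suc t) ≡ walk c' (suc t') → walk c t ≡ walk c' t'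
    walk-suc-injective {c} {c'} start start' t t' alive alive' walk≡walk' =
      row₂-unique (symbol₂∋ (walk c t))
                  (subst (λ z → A i₂ (walk c' t') z ≡ 1ℤ) (sym same-symbol) (symbol₂∋ (walk c' t')))
      where
      valid  = walk-valid start (suc t) alive
      valid' = walk-valid start' (suc t') alive'
      same-symbol : exitSymbol c t ≡ exitSymbol c' t'
      same-symbol = cell-unique (proj₁ valid' ∘ proj₂) (proj₂ valid')
                      (subst (λ y → A i₁ y (exitSymbol c t) ≡ 1ℤ) walk≡walk' (proj₂ valid))

    walk-injective : ∀ {c c'} → Start c → Start c' → ∀ t t' → Alive c t → Alive c' t' →
                     walk c t ≡ walk c' t' → t ≡ t' × c ≡ c'
    walk-injective start start' zero    zero     _     _      c≡c'    = refl , c≡c'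
    walk-injective start start' zero    (suc t') _     alive' c≡walk' =
      contradiction (sym c≡walk') (walk-suc≢start start' start t' alive')
    walk-injective start start' (suc t) zero     alive _      walk≡c' =
      contradiction walk≡c' (walk-suc≢start start start' t alive)
    walk-injective start start' (suc t) (suc t') alive alive' walk≡walk' =
      map₁ (cong suc) (walk-injective start start' t t' (Alive-pred alive) (Alive-pred alive')
                         (walk-suc-injective start start' t t' alive alive' walk≡walk'))

    private
      i₁js≡-1 : A i₁ j s ≡ -1ℤ
      i₁js≡-1 = trans (improperCell s) (cong₂ _-_ (cong₂ _+_ (δ-≢ u≢a) (δ-≢ u≢b)) (δ-refl s))

      lifted : ZeroOneValued (λ y → A i₁ y s + δ y j) × sumFin n (λ y → A i₁ y s + δ y j) ≡ + 2
      lifted = ZeroOne-lift-−1 n (λ y y≢j → zeroOne i₁ y s (y≢j ∘ proj₂)) i₁js≡-1 (rowSums i₁ s)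

      lifted⇒Start : ∀ {y} → A i₁ y s + δ y j ≡ 1ℤ → Start y
      lifted⇒Start {y} lifted≡1 =
        y≢j , trans (sym (ℤ.+-identityʳ _)) (trans (cong (_+_ (A i₁ y s)) (sym (δ-≢ y≢j))) lifted≡1)
        where
        y≢j : y ≢ j
        y≢j refl = contradiction (trans (sym lifted≡1) (cong₂ _+_ i₁js≡-1 (δ-refl j))) λ ()

    two-starts : ∃ λ x₀ → ∃ λ y₀ → x₀ ≢ y₀ × Start x₀ × Start y₀
    two-starts with ZeroOne-sum≢0 n (proj₁ lifted) (≡+suc⇒≢0 (proj₂ lifted))
    ... | x₀ , lifted-x₀≡1 with ZeroOne-sum≡2 n (proj₁ lifted) (proj₂ lifted) lifted-x₀≡1
    ...   | y₀ , y₀≢x₀ , lifted≗ =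
      x₀ , y₀ , y₀≢x₀ ∘ sym , lifted⇒Start lifted-x₀≡1 ,
      lifted⇒Start (trans (lifted≗ y₀) (cong₂ _+_ (δ-≢ y₀≢x₀) (δ-refl y₀)))

    ShortWalk : Set
    ShortWalk = ∃ λ c → ∃ λ t → Start c × Alive c t × Stops c t × 2 ℕ.* suc t ≤ n ∸ 1

    module Lockstep {x₀ y₀} (x₀≢y₀ : x₀ ≢ y₀) (start₀ : Start x₀) (start₁ : Start y₀) where

      both-alive-bound : ∀ t → Alive x₀ t → Alive y₀ t → 2 ℕ.* suc t ≤ n ∸ 1
      both-alive-bound t alive₀ alive₁ =
        subst (_≤ n ∸ 1) (cong (suc t ℕ.+_) (sym (ℕₚ.+-identityʳ (suc t))))
          (disjoint-injections-≤ j {f = walk x₀ ∘ toℕ} {g = walk y₀ ∘ toℕ}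
            (Fin.toℕ-injective ∘ proj₁ ∘ injective start₀ start₀ alive₀ alive₀)
            (Fin.toℕ-injective ∘ proj₁ ∘ injective start₁ start₁ alive₁ alive₁)
            (λ i i' → x₀≢y₀ ∘ proj₂ ∘ injective start₀ start₁ alive₀ alive₁ {i} {i'})
            (λ i → proj₁ (walk-valid start₀ _ (alive-at alive₀ i)))
            (λ i → proj₁ (walk-valid start₁ _ (alive-at alive₁ i))))
        where
        alive-at : ∀ {c} → Alive c t → (i : Fin (suc t)) → Alive c (toℕ i)
        alive-at alive i = Alive-≤ (Fin.toℕ≤pred[n] i) alive
        injective : ∀ {c c'} → Start c → Start c' → Alive c t → Alive c' t → ∀ {i i'} →
                    walk c (toℕ i) ≡ walk c' (toℕ i') → toℕ i ≡ toℕ i' × c ≡ c'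
        injective start start' alive alive' {i} {i'} =
          walk-injective start start' _ _ (alive-at alive i) (alive-at alive' i')

      lockstep : ∀ t → ShortWalk ⊎ (Alive x₀ t × Alive y₀ t)
      lockstep zero = inj₂ ((λ _ ()) , (λ _ ()))
      lockstep (suc t) with lockstep t
      ... | inj₁ short = inj₁ short
      ... | inj₂ (alive₀ , alive₁) with stops? x₀ t | stops? y₀ t
      ...   | inj₁ stops₀     | _               =
        inj₁ (x₀ , t , start₀ , alive₀ , stops₀ , both-alive-bound t alive₀ alive₁)
      ...   | inj₂ _          | inj₁ stops₁     =
        inj₁ (y₀ , t , start₁ , alive₁ , stops₁ , both-alive-bound t alive₀ alive₁)
      ...   | inj₂ continues₀ | inj₂ continues₁ =
        inj₂ (Alive-suc alive₀ continues₀ , Alive-suc alive₁ continues₁)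

      shortWalk : ShortWalk
      shortWalk = [ id , (λ (alive₀ , alive₁) → contradiction (both-alive-bound n alive₀ alive₁) too-long) ]′
                    (lockstep n)
        where
        too-long : ¬ (2 ℕ.* suc n ≤ n ∸ 1)
        too-long = ℕₚ.<⇒≱ (ℕ.s≤s (ℕₚ.≤-trans (ℕₚ.m∸n≤m n 1) (ℕₚ.m≤m+n n (suc n ℕ.+ 0))))

    shortWalk : ShortWalk
    shortWalk = let _ , _ , x₀≢y₀ , start₀ , start₁ = two-starts in Lockstep.shortWalk x₀≢y₀ start₀ start₁

    module Run {c t} (start : Start c) (alive : Alive c t) (stops : Stops c t) where

      AgreesOffWalk : Arr n → ℕ → Set
      AgreesOffWalk C r = ∀ x y z → y ≢ j → (∀ r' → r' ℕ.< r → y ≢ walk c r') → C x y z ≡ A x y z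

      module StepAt {r} (r≤t : r ≤ t) {C} (I : Improper C (entrySymbol c r)) (agrees : AgreesOffWalk C r) where
        private
          alive-r : Alive c r
          alive-r = Alive-≤ r≤t alive

          valid = walk-valid start r alive-r

          fresh : ∀ r' → r' ℕ.< r → walk c r ≢ walk c r'
          fresh r' r'<r eq = ℕₚ.<⇒≢ r'<r
            (sym (proj₁ (walk-injective start start r r' alive-r (Alive-≤ (ℕₚ.<⇒≤ r'<r) alive-r) eq)))

          agrees-here : ∀ x z → C x (walk c r) z ≡ A x (walk c r) z
          agrees-here x z = agrees x (walk c r) z (proj₁ valid) fresh

        open Move I (proj₁ valid) (trans (agrees-here i₁ _) (proj₂ valid))
                    (trans (agrees-here i₂ _) (symbol₂∋ (walk c r))) public

        C'-agrees : AgreesOffWalk C' (suc r)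
        C'-agrees x y z y≢j off-walk =
          trans (C'-outside-columns y≢j (off-walk r (ℕₚ.n<1+n r)) x z)
                (agrees x y z y≢j (λ r' r'<r → off-walk r' (ℕₚ.m<n⇒m<1+n r'<r)))

      -- r moves along the walk have been made; d + 1 remain.
      moves : ∀ r d → r ℕ.+ d ≡ t → (C : Arr n) → Improper C (entrySymbol c r) → AgreesOffWalk C r →
              Σ (Arr n) λ B → ProperLS B × Steps (MoveInRows i₁ i₂) (suc d) C B
      moves r zero r+0≡t C I agrees = C' , C'-proper (subst (Stops c) (sym r≡t) stops) , step move done
        where
        r≡t = trans (sym (ℕₚ.+-identityʳ r)) r+0≡t
        open StepAt (ℕₚ.≤-reflexive r≡t) I agrees
      moves r (suc d) r+1+d≡t C I agrees =
        let B , proper , steps = moves (suc r) d (trans (sym (ℕₚ.+-suc r d)) r+1+d≡t) C'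
                                   (C'-improper (proj₁ continues) (proj₂ continues)) C'-agrees
        in B , proper , step move steps
        where
        r<t : r ℕ.< t
        r<t = subst (r ℕ.<_) r+1+d≡t (ℕₚ.m<m+n r ℕ.z<s)
        continues = alive r r<t
        open StepAt (ℕₚ.<⇒≤ r<t) I agrees

lemma1 : (n : ℕ) (A : Arr n) (i₁ i₂ j a b s : Fin n) →
    ImproperLS A →
    A i₁ j s ≡ -1ℤ → A i₁ j a ≡ 1ℤ → A i₁ j b ≡ 1ℤ → a ≢ b →
    i₂ ≢ i₁ → A i₂ j s ≡ 1ℤ →
    Σ ℕ λ k → (2 ℕ.* k ≤ n ∸ 1) ×
      Σ (Arr n) λ B → ProperLS B × Steps (MoveInRows i₁ i₂) k A B
lemma1 n A i₁ i₂ j a b s improperLS i₁js≡-1 i₁ja≡1 i₁jb≡1 a≢b i₂≢i₁ i₂js≡1 =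
  let _ , t , start , alive , stops , short = shortWalk
  in suc t , short , Run.moves start alive stops 0 t refl A I (λ _ _ _ _ _ → refl)
  where
  open TwoRows i₁ i₂ j a b i₂≢i₁ a≢b
  I : Improper A s
  I = Improper-initial improperLS i₁js≡-1 i₁ja≡1 i₁jb≡1 i₂js≡1
  open Walks I
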